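{- Let $g\ge1$. For each positive integer $d$, let $M_d^g$ be the number of equivalence classes of oriented maximal Wicks forms of genus $g$ whose automorphism group has order divisible by $d$. Among the equivalence classes of oriented maximal Wicks forms of genus $g$: - exactly $M_6^g$ have an automorphism group of order $6$; - exactly $M_3^g-M_6^g$ have an automorphism group of order $3$; - exactly $M_2^g-M_6^g$ have an automorphism group of order $2$; - exactly $M_1^g-M_2^g-M_3^g+M_6^g$ have trivial automorphism group.
   Context: An oriented Wicks form is a cyclic word $w=w_1\cdots w_{2l}$ over an alphabet $a_1^{\pm1},a_2^{\pm1},\dots$ such that: (1) if $a_i^{\epsilon}$ appears, then $a_i^{ -\epsilon}$ appears exactly once; (2) there is no cyclic factor $a_ia_i^{ -1}$ or $a_i^{ -1}a_i$; (3) if $a_i^{\epsilon}a_j^{\delta}$ is a cyclic factor, then $a_j^{ -\delta}a_i^{ -\epsilon}$ is not. Forms are equivalent (isomorphic) if they agree as cyclic words after a bijection $\varphi$ of alphabets with $\varphi(a^{ -1})=\varphi(a)^{ -1}$. The genus is the genus of the closed oriented surface obtained by gluing a $2l$-gon labelled and oriented according to $w$. A form of genus $g$ is maximal if its length is $6(2g-1)$. $\mathrm{Aut}(w)$, for $w=w_1\cdots w_{2e}$, is the group of cyclic shifts $\mu$ of the linear word $w_1\cdots w_{2e}$ such that $\mu(w)$ is obtained from $w$ by a bijection of the alphabet compatible with inverses. It is a subgroup of $\mathbb{Z}/2e\mathbb{Z}$. -}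

module Defs where

open import Data.Nat using (ℕ; zero; suc; _+_; _*_; _∸_)
open import Data.Nat.Divisibility using (_∣_)
open import Data.Unit using (⊤)
open import Data.Nat.DivMod using (_mod_)
open import Data.Fin using (Fin; toℕ)
open import Data.Bool using (Bool; not)
open import Data.Product using (Σ; ∃; _×_; _,_; proj₁)
open import Relation.Binary.PropositionalEquality using (_≡_)
open import Relation.Nullary using (¬_)

HasCount : {m : ℕ} → (Fin m → Set) → ℕ → Set
HasCount {m} P n =
  Σ (Fin n → Fin m) λ f →
    (∀ i → P (f i)) ×
    (∀ i j → f i ≡ f j → i ≡ j) ×
    (∀ k → P k → ∃ λ i → f i ≡ k)

HasClassCount : {A : Set} → (A → A → Set) → (A → Set) → ℕ → Set
HasClassCount {A} _~_ P n =
  Σ (Fin n → A) λ r →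
    (∀ i → P (r i)) ×
    (∀ i j → r i ~ r j → i ≡ j) ×
    (∀ x → P x → ∃ λ i → x ~ r i)

-- Letter e: a_i^{+1} is (i , true), a_i^{-1} is (i , false), i : Fin e.
Letter : ℕ → Set
Letter e = Fin e × Bool

inv : {e : ℕ} → Letter e → Letter e
inv (i , b) = (i , not b)

-- A (linear representative of a cyclic) word of length 2e.
Word : ℕ → Set
Word e = Fin (2 * e) → Letter e

shift : {n : ℕ} → Fin n → Fin n → Fin n
shift {suc n} k i = (toℕ i + toℕ k) mod (suc n)

next : {n : ℕ} → Fin n → Fin n
next {suc n} i = (toℕ i + 1) mod (suc n)

IsRelabeling : {e : ℕ} → (Letter e → Letter e) → Set
IsRelabeling {e} φ =
  (Σ (Letter e → Letter e) λ ψ → (∀ x → ψ (φ x) ≡ x) × (∀ x → φ (ψ x) ≡ x)) ×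
  (∀ x → φ (inv x) ≡ inv (φ x))

-- Oriented Wicks forms (alphabet normalised to a_1..a_e, all used)

IsWicks : {e : ℕ} → Word e → Set
IsWicks {e} w =
  (∀ (a : Fin e) → ∃ λ i → proj₁ (w i) ≡ a) ×
  (∀ i → Σ (Fin (2 * e)) λ j → (w j ≡ inv (w i)) × (∀ j′ → w j′ ≡ inv (w i) → j′ ≡ j)) ×
  (∀ i → ¬ (w (next i) ≡ inv (w i))) ×
  -- (3) if x y is a cyclic factor then y^{-1} x^{-1} is not
  (∀ i j → ¬ ((w j ≡ inv (w (next i))) × (w (next j) ≡ inv (w i))))

-- Corner i of the 2e-gon is the vertex between w_{i-1} and w_i; the
-- edge w_i runs from corner i to corner i+1.  Gluing the edge at p with
-- the edge at q (w_q = w_p^{-1}) identifies corner p+1 with corner q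
-- (and, by the symmetric instance, corner q+1 with corner p).
data CornerEq {e : ℕ} (w : Word e) : Fin (2 * e) → Fin (2 * e) → Set where
  glue  : ∀ {p q} → w q ≡ inv (w p) → CornerEq w (next p) q
  c-refl  : ∀ {i} → CornerEq w i i
  c-sym   : ∀ {i j} → CornerEq w i j → CornerEq w j i
  c-trans : ∀ {i j k} → CornerEq w i j → CornerEq w j k → CornerEq w i k

NumVertices : {e : ℕ} → Word e → ℕ → Set
NumVertices w V = HasClassCount (CornerEq w) (λ _ → ⊤) V

-- genus g:  V - E + F = 2 - 2g  with E = e, F = 1, i.e.  V + 2g = e + 1
HasGenus : {e : ℕ} → Word e → ℕ → Set
HasGenus {e} w g = ∃ λ V → NumVertices w V × (V + 2 * g ≡ e + 1)

-- Maximal forms of genus g: length 2e = 6(2g-1), i.e. e = 3(2g-1)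

maxE : ℕ → ℕ
maxE g = 3 * (2 * g ∸ 1)

IsMaxForm : (g : ℕ) → Word (maxE g) → Set
IsMaxForm g w = IsWicks w × HasGenus w g

Equiv : {e : ℕ} → Word e → Word e → Set
Equiv {e} u v =
  Σ (Fin (2 * e)) λ k → Σ (Letter e → Letter e) λ φ →
    IsRelabeling φ × (∀ i → v i ≡ φ (u (shift k i)))

IsAut : {e : ℕ} → Word e → Fin (2 * e) → Set
IsAut {e} w k =
  Σ (Letter e → Letter e) λ φ → IsRelabeling φ × (∀ i → w (shift k i) ≡ φ (w i))

AutOrder : {e : ℕ} → Word e → ℕ → Set
AutOrder w n = HasCount (IsAut w) n

NumMaxClasses : (g : ℕ) → (Word (maxE g) → Set) → ℕ → Set
NumMaxClasses g P n = HasClassCount Equiv (λ w → IsMaxForm g w × P w) n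

IsM : ℕ → ℕ → ℕ → Set
IsM g d m = NumMaxClasses g (λ w → ∃ λ a → AutOrder w a × d ∣ a) m

{-# OPTIONS --safe #-}
-- Number the positions of w and the corners of the 2e-gon by ℤ/2e, corner x lying between
-- w_{x-1} and w_x, and let π x be the position of w_x⁻¹.  Gluing identifies corner π x + 1
-- with x, so the vertices of the surface are the cycles of σ x = π x + 1.  By (2) and (3)
-- every vertex has degree at least 3, and a maximal form of genus g has 2e/3 vertices, so
-- σ³ = id.  Aut(w) is a subgroup of ℤ/2e, generated by a shift m with |Aut(w)| · m = 2e;
-- write q = |Aut(w)|.  Give corner x the level ⌊x/m⌋ mod q and let h x be the sum of the
-- levels of x, σ x, σ² x.  Then h is constant on vertices and the shift by m raises it by 3.
-- Over the fundamental domain 0 ≤ i < m of the shift, the increments h (i+1) - h i telescope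
-- to 3, while pairing each edge i with π i (which commutes with the shift) shows that their
-- sum is its own negative.  Hence 6 ≡ 0 mod q, i.e. |Aut(w)| divides 6, and the four counts
-- follow by inclusion-exclusion over the divisors 1, 2, 3, 6.
module Submission where

open import Defs
open import Level using (0ℓ)
open import Algebra.Bundles using (CommutativeMonoid)
open import Algebra.Structures using (IsCommutativeMonoid)
open import Data.Bool using (Bool)
open import Data.Bool.Properties using (not-involutive)
open import Data.Empty using (⊥-elim)
open import Data.Fin using (Fin; zero; suc; toℕ; fromℕ<; remQuot; combine) renaming (_≟_ to _≟ᶠ_)
open import Data.Fin.Permutation using (permutation)
open import Data.Fin.Properties
  using (toℕ-fromℕ<; toℕ-injective; toℕ<n; injective⇒≤; suc-injective; combine-remQuot)
open import Data.List using (List; []; _∷_; map)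
open import Data.List.Membership.Propositional using (_∈_)
open import Data.List.Properties using (∷-injective)
open import Data.List.Relation.Unary.Any using (here; there)
open import Data.Nat
  using (ℕ; zero; suc; pred; _+_; _*_; _∸_; _%_; _/_; _<_; _≤_; _≥_; _≤?_; _≟_; s≤s; z≤n; NonZero)
open import Data.Nat.DivMod
  using (_mod_; %-congʳ; %-distribˡ-+; +-distrib-/-∣ʳ; [m+kn]%n≡m%n; m%[n*o]/o≡m/o%n; m%n%n≡m%n; m%n<n;
         m*n%n≡0; m*n/n≡m; m<n⇒m%n≡m; m∣n⇒o%n%m≡o%m; m≡m%n+[m/n]*n; n%n≡0)
open import Data.Nat.Divisibility
  using (_∣_; module _∣_; quotient; _∣?_; divides; ∣-refl; ∣-trans; ∣⇒≤; m%n≡0⇒n∣m)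
open import Data.Nat.GCD using (gcd; gcd-GCD; gcd[m,n]∣m; gcd[m,n]∣n; module Bézout)
open import Data.Nat.Properties
  using (*-cancelʳ-<; *-cancelʳ-≡; *-identityˡ; *-monoˡ-<; *-suc; +-0-commutativeMonoid; +-assoc;
         +-cancelʳ-≡; +-comm; +-identityʳ; +-suc; <-irrefl; <-≤-trans; m*n≢0; m*n≢0⇒m≢0; m*n≢0⇒n≢0;
         m≤n*m; m≤n+m; suc-pred; ≤-antisym)
open import Data.Nat.Tactic.RingSolver using (solve-∀)
open import Data.Product using (Σ; ∃; ∃₂; _×_; _,_; proj₁; proj₂; uncurry)
open import Data.Unit using (⊤; tt)
open import Data.Vec.Functional using (foldr)
open import Function using (id; _∘_)
open import Relation.Binary.Definitions using (Symmetric; Transitive)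
open import Relation.Binary.PropositionalEquality
import Relation.Binary.Reasoning.Setoid
open import Relation.Binary.Structures using (IsEquivalence)
open import Relation.Nullary using (¬_; Dec; yes; no; does; contradiction)
open import Relation.Nullary.Decidable using (from-no)
open import Relation.Unary using (Pred; Decidable; _∩_; ∁)
open import Relation.Unary.Properties using (_∩?_; ∁?)

-- Arithmetic modulo q and telescoping sums

module Modulo (q : ℕ) .{{_ : NonZero q}} where

  infix 4 _≈_
  _≈_ : ℕ → ℕ → Set
  a ≈ b = a % q ≡ b % q

  %-≈ : ∀ a → a % q ≈ a
  %-≈ a = m%n%n≡m%n a q

  +-cong : ∀ {a b c d} → a ≈ b → c ≈ d → a + c ≈ b + d
  +-cong {a} {b} {c} {d} a≈b c≈d = begin
    (a + c) % q           ≡⟨ %-distribˡ-+ a c q ⟩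
    (a % q + c % q) % q   ≡⟨ cong₂ (λ x y → (x + y) % q) a≈b c≈d ⟩
    (b % q + d % q) % q   ≡⟨ %-distribˡ-+ b d q ⟨
    (b + d) % q           ∎
    where open ≡-Reasoning

  +-isCommutativeMonoid : IsCommutativeMonoid _≈_ _+_ 0
  +-isCommutativeMonoid = record
    { isMonoid = record
      { isSemigroup = record
        { isMagma = record
          { isEquivalence = record { refl = refl ; sym = sym ; trans = trans }
          ; ∙-cong = +-cong }
        ; assoc = λ a b c → cong (_% q) (+-assoc a b c) }
      ; identity = (λ _ → refl) , (λ a → cong (_% q) (+-identityʳ a)) }
    ; comm = λ a b → cong (_% q) (+-comm a b) }

  +-commutativeMonoid : CommutativeMonoid 0ℓ 0ℓ
  +-commutativeMonoid = record { isCommutativeMonoid = +-isCommutativeMonoid }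

  +-cancelˡ : ∀ x {a b} → x + a ≈ x + b → a ≈ b
  +-cancelˡ x {a} {b} x+a≈x+b = begin
    a % q                      ≡⟨ [m+kn]%n≡m%n a x q ⟨
    (a + x * q) % q            ≡⟨ cong (_% q) (shuffle a) ⟩
    (x + a + x * pred q) % q   ≡⟨ +-cong x+a≈x+b refl ⟩
    (x + b + x * pred q) % q   ≡⟨ cong (_% q) (shuffle b) ⟨
    (b + x * q) % q            ≡⟨ [m+kn]%n≡m%n b x q ⟩
    b % q                      ∎
    where
    open ≡-Reasoning
    shuffle : ∀ c → c + x * q ≡ x + c + x * pred q
    shuffle c = begin
      c + x * q              ≡⟨ cong (λ r → c + x * r) (suc-pred q) ⟨
      c + x * suc (pred q)   ≡⟨ cong (c +_) (*-suc x (pred q)) ⟩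
      c + (x + x * pred q)   ≡⟨ +-assoc c x _ ⟨
      c + x + x * pred q     ≡⟨ cong (_+ x * pred q) (+-comm c x) ⟩
      x + c + x * pred q     ∎

  m+n≈m⇒q∣n : ∀ x {a} → x + a ≈ x → q ∣ a
  m+n≈m⇒q∣n x {a} x+a≈x = m%n≡0⇒n∣m a q
    (trans (+-cancelˡ x (trans x+a≈x (cong (_% q) (sym (+-identityʳ x))))) (m*n%n≡0 0 q))

module _ where
  open import Algebra.Properties.CommutativeMonoid.Sum +-0-commutativeMonoid using (sum-syntax)

  ∑-telescope : ∀ n (H : ℕ → ℕ) → ∑[ i < n ] H (suc (toℕ i)) + H 0 ≡ ∑[ i < n ] H (toℕ i) + H n
  ∑-telescope zero H = refl
  ∑-telescope (suc n) H = begin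
    H 1 + S₂ + H 0          ≡⟨ cong (_+ H 0) (+-comm (H 1) S₂) ⟩
    S₂ + H 1 + H 0          ≡⟨ cong (_+ H 0) (∑-telescope n (H ∘ suc)) ⟩
    S₁ + H (suc n) + H 0    ≡⟨ +-assoc S₁ _ _ ⟩
    S₁ + (H (suc n) + H 0)  ≡⟨ cong (S₁ +_) (+-comm (H (suc n)) (H 0)) ⟩
    S₁ + (H 0 + H (suc n))  ≡⟨ +-assoc S₁ _ _ ⟨
    S₁ + H 0 + H (suc n)    ≡⟨ cong (_+ H (suc n)) (+-comm S₁ (H 0)) ⟩
    H 0 + S₁ + H (suc n)    ∎
    where
    open ≡-Reasoning
    S₁ S₂ : ℕ
    S₁ = ∑[ i < n ] H (suc (toℕ i))
    S₂ = ∑[ i < n ] H (suc (suc (toℕ i)))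

-- Positions on a cycle

module _ {n : ℕ} where
  open Modulo (suc n)

  -- By definition shift k i = i ⊕ toℕ k and next i = i ⊕ 1.
  infixl 6 _⊕_

  pos : ℕ → Fin (suc n)
  pos k = k mod suc n

  _⊕_ : Fin (suc n) → ℕ → Fin (suc n)
  x ⊕ a = pos (toℕ x + a)

  toℕ-pos : ∀ k → toℕ (pos k) ≡ k % suc n
  toℕ-pos k = toℕ-fromℕ< (m%n<n k (suc n))

  toℕ-pos≈ : ∀ k → toℕ (pos k) ≈ k
  toℕ-pos≈ k = trans (cong (_% suc n) (toℕ-pos k)) (%-≈ k)

  pos-toℕ : ∀ x → pos (toℕ x) ≡ x
  pos-toℕ x = toℕ-injective (trans (toℕ-pos (toℕ x)) (m<n⇒m%n≡m (toℕ<n x)))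

  pos-cong : ∀ k l → k ≈ l → pos k ≡ pos l
  pos-cong k l k≈l = toℕ-injective (trans (toℕ-pos k) (trans k≈l (sym (toℕ-pos l))))

  ⊕-congʳ : ∀ x {a b} → a ≈ b → x ⊕ a ≡ x ⊕ b
  ⊕-congʳ x {a} {b} a≈b = pos-cong (toℕ x + a) (toℕ x + b) (+-cong {toℕ x} {toℕ x} {a} {b} refl a≈b)

  pos-⊕ : ∀ k a → pos k ⊕ a ≡ pos (k + a)
  pos-⊕ k a = pos-cong (toℕ (pos k) + a) (k + a) (+-cong {toℕ (pos k)} {k} {a} {a} (toℕ-pos≈ k) refl)

  ⊕-toℕ-pos : ∀ x a → x ⊕ toℕ (pos a) ≡ x ⊕ a
  ⊕-toℕ-pos x a = ⊕-congʳ x (toℕ-pos≈ a)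

  ⊕-assoc : ∀ x a b → x ⊕ a ⊕ b ≡ x ⊕ (a + b)
  ⊕-assoc x a b = trans (pos-⊕ (toℕ x + a) b) (cong pos (+-assoc (toℕ x) a b))

  ⊕-comm : ∀ x a b → x ⊕ a ⊕ b ≡ x ⊕ b ⊕ a
  ⊕-comm x a b = trans (⊕-assoc x a b) (trans (cong (x ⊕_) (+-comm a b)) (sym (⊕-assoc x b a)))

  ⊕-identityʳ : ∀ x → x ⊕ 0 ≡ x
  ⊕-identityʳ x = trans (cong pos (+-identityʳ (toℕ x))) (pos-toℕ x)

  ⊕-inverse : ∀ x a → x ⊕ a ⊕ a * n ≡ x
  ⊕-inverse x a = begin
    x ⊕ a ⊕ a * n      ≡⟨ ⊕-assoc x a (a * n) ⟩
    x ⊕ (a + a * n)    ≡⟨ cong (x ⊕_) (*-suc a n) ⟨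
    x ⊕ a * suc n      ≡⟨ ⊕-congʳ x (m*n%n≡0 a (suc n)) ⟩
    x ⊕ 0              ≡⟨ ⊕-identityʳ x ⟩
    x                  ∎
    where open ≡-Reasoning

  ⊕-injective : ∀ {x y} a → x ⊕ a ≡ y ⊕ a → x ≡ y
  ⊕-injective {x} {y} a eq =
    trans (sym (⊕-inverse x a)) (trans (cong (_⊕ a * n) eq) (⊕-inverse y a))

  negate : Fin (suc n) → Fin (suc n)
  negate k = pos (toℕ k * n)

  shift-negate : ∀ k i → shift k (shift (negate k) i) ≡ i
  shift-negate k i = begin
    i ⊕ toℕ (pos (toℕ k * n)) ⊕ toℕ k  ≡⟨ cong (_⊕ toℕ k) (⊕-toℕ-pos i (toℕ k * n)) ⟩
    i ⊕ toℕ k * n ⊕ toℕ k              ≡⟨ ⊕-comm i (toℕ k * n) (toℕ k) ⟩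
    i ⊕ toℕ k ⊕ toℕ k * n              ≡⟨ ⊕-inverse i (toℕ k) ⟩
    i                                  ∎
    where open ≡-Reasoning

  shift-shift : ∀ k l i → shift k (shift l i) ≡ shift (shift k l) i
  shift-shift k l i = trans (⊕-assoc i (toℕ l) (toℕ k)) (sym (⊕-toℕ-pos i (toℕ l + toℕ k)))

  shift-comm : ∀ k l i → shift k (shift l i) ≡ shift l (shift k i)
  shift-comm k l i = ⊕-comm i (toℕ l) (toℕ k)

module _ {e : ℕ} where

  relabeling⁻¹ : {φ : Letter e → Letter e} → IsRelabeling φ → Letter e → Letter e
  relabeling⁻¹ ((ψ , _) , _) = ψ

  relabeling⁻¹-φ : ∀ {φ} (R : IsRelabeling {e} φ) x → relabeling⁻¹ R (φ x) ≡ x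
  relabeling⁻¹-φ ((_ , ψφ , _) , _) = ψφ

  id-isRelabeling : IsRelabeling {e} id
  id-isRelabeling = (id , (λ _ → refl) , (λ _ → refl)) , (λ _ → refl)

  ∘-isRelabeling : ∀ {φ ψ} → IsRelabeling {e} φ → IsRelabeling ψ → IsRelabeling (φ ∘ ψ)
  ∘-isRelabeling {φ} {ψ} ((φ⁻¹ , φ⁻¹φ , φφ⁻¹) , φ-inv) ((ψ⁻¹ , ψ⁻¹ψ , ψψ⁻¹) , ψ-inv) =
    (ψ⁻¹ ∘ φ⁻¹ , (λ x → trans (cong ψ⁻¹ (φ⁻¹φ (ψ x))) (ψ⁻¹ψ x))
               , (λ x → trans (cong φ (ψψ⁻¹ (φ⁻¹ x))) (φφ⁻¹ x))) ,
    (λ x → trans (cong φ (ψ-inv x)) (φ-inv (ψ x)))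

  ⁻¹-isRelabeling : ∀ {φ} (R : IsRelabeling {e} φ) → IsRelabeling (relabeling⁻¹ R)
  ⁻¹-isRelabeling {φ} ((φ⁻¹ , φ⁻¹φ , φφ⁻¹) , φ-inv) = (φ , φφ⁻¹ , φ⁻¹φ) , λ x → begin
    φ⁻¹ (inv x)            ≡⟨ cong (φ⁻¹ ∘ inv) (φφ⁻¹ x) ⟨
    φ⁻¹ (inv (φ (φ⁻¹ x)))  ≡⟨ cong φ⁻¹ (φ-inv (φ⁻¹ x)) ⟨
    φ⁻¹ (φ (inv (φ⁻¹ x)))  ≡⟨ φ⁻¹φ (inv (φ⁻¹ x)) ⟩
    inv (φ⁻¹ x)            ∎
    where open ≡-Reasoning

Equiv-sym : ∀ {e} → Symmetric (Equiv {e})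
Equiv-sym {suc e} {u} {v} (k , φ , R , v≡) =
  negate k , relabeling⁻¹ R , ⁻¹-isRelabeling R , λ i → begin
    u i                                          ≡⟨ cong u (shift-negate k i) ⟨
    u (shift k (shift (negate k) i))             ≡⟨ relabeling⁻¹-φ R _ ⟨
    relabeling⁻¹ R (φ (u (shift k (shift (negate k) i)))) ≡⟨ cong (relabeling⁻¹ R) (v≡ _) ⟨
    relabeling⁻¹ R (v (shift (negate k) i))      ∎
  where open ≡-Reasoning

Equiv-trans : ∀ {e} → Transitive (Equiv {e})
Equiv-trans {suc e} {u} {v} {x} (k , φ , R , v≡) (l , ψ , S , x≡) =
  shift k l , ψ ∘ φ , ∘-isRelabeling S R , λ i →
    trans (x≡ i) (cong ψ (trans (v≡ (shift l i)) (cong (φ ∘ u) (shift-shift k l i))))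

IsAut-transport : ∀ {e} {u v : Word e} → Equiv u v → ∀ {s} → IsAut u s → IsAut v s
IsAut-transport {suc e} {u} {v} (k , φ , R , v≡) {s} (ψ , S , u∘s≡) =
  φ ∘ ψ ∘ relabeling⁻¹ R , ∘-isRelabeling R (∘-isRelabeling S (⁻¹-isRelabeling R)) , λ i → begin
    v (shift s i)                              ≡⟨ v≡ (shift s i) ⟩
    φ (u (shift k (shift s i)))                ≡⟨ cong (φ ∘ u) (shift-comm k s i) ⟩
    φ (u (shift s (shift k i)))                ≡⟨ cong φ (u∘s≡ (shift k i)) ⟩
    φ (ψ (u (shift k i)))                      ≡⟨ cong (φ ∘ ψ) (relabeling⁻¹-φ R _) ⟨
    φ (ψ (relabeling⁻¹ R (φ (u (shift k i))))) ≡⟨ cong (φ ∘ ψ ∘ relabeling⁻¹ R) (v≡ i) ⟨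
    φ (ψ (relabeling⁻¹ R (v i)))               ∎
  where open ≡-Reasoning

-- Counting elements and equivalence classes

module _ {m : ℕ} {P : Pred (Fin (suc m)) 0ℓ} where

  count-cons : ∀ {k} → HasCount (P ∘ suc) k → P zero → HasCount P (suc k)
  count-cons {k} (f , fP , f-inj , f-cover) P0 = f′ , f′P , f′-inj , f′-cover
    where
    f′ : Fin (suc k) → Fin (suc m)
    f′ zero = zero
    f′ (suc i) = suc (f i)
    f′P : ∀ i → P (f′ i)
    f′P zero = P0
    f′P (suc i) = fP i
    f′-inj : ∀ i j → f′ i ≡ f′ j → i ≡ j
    f′-inj zero zero _ = refl
    f′-inj (suc i) (suc j) eq = cong suc (f-inj i j (suc-injective eq))
    f′-cover : ∀ x → P x → ∃ λ i → f′ i ≡ x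
    f′-cover zero _ = zero , refl
    f′-cover (suc x) Px = let (i , fi≡x) = f-cover x Px in suc i , cong suc fi≡x

  count-skip : ∀ {k} → HasCount (P ∘ suc) k → ¬ P zero → HasCount P k
  count-skip (f , fP , f-inj , f-cover) ¬P0 =
    suc ∘ f , fP , (λ i j eq → f-inj i j (suc-injective eq)) , cover
    where
    cover : ∀ x → P x → ∃ λ i → suc (f i) ≡ x
    cover zero P0 = ⊥-elim (¬P0 P0)
    cover (suc x) Px = let (i , fi≡x) = f-cover x Px in i , cong suc fi≡x

count-split : ∀ {m} {D : Pred (Fin m) 0ℓ} → Decidable D →
  ∃₂ λ k k′ → HasCount D k × HasCount (∁ D) k′ × k + k′ ≡ m
count-split {zero} D? = 0 , 0 , empty , empty , refl
  where
  empty : ∀ {Q : Pred (Fin 0) 0ℓ} → HasCount Q 0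
  empty = (λ ()) , (λ ()) , (λ ()) , (λ ())
count-split {suc m} D? with count-split (D? ∘ suc) | D? zero
... | k , k′ , C , C′ , k+k′≡m | yes D0 =
  suc k , k′ , count-cons C D0 , count-skip C′ (λ ¬D0 → ¬D0 D0) , cong suc k+k′≡m
... | k , k′ , C , C′ , k+k′≡m | no ¬D0 =
  k , suc k′ , count-skip C ¬D0 , count-cons C′ ¬D0 , trans (+-suc k k′) (cong suc k+k′≡m)

module _ {A : Set} {_~_ : A → A → Set} {P : Pred A 0ℓ} where

  classCount-≤ : Symmetric _~_ → Transitive _~_ → ∀ {a b} →
    HasClassCount _~_ P a → HasClassCount _~_ P b → a ≤ b
  classCount-≤ ~-sym ~-trans {a} {b} (r , rP , r-inj , _) (s , _ , _ , s-cover) =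
    injective⇒≤ {f = index} λ {i} {j} eq →
      r-inj i j (~-trans (r~s i) (~-sym (subst (λ t → r j ~ s t) (sym eq) (r~s j))))
    where
    index : Fin a → Fin b
    index i = proj₁ (s-cover (r i) (rP i))
    r~s : ∀ i → r i ~ s (index i)
    r~s i = proj₂ (s-cover (r i) (rP i))

  classCount-unique : Symmetric _~_ → Transitive _~_ → ∀ {a b} →
    HasClassCount _~_ P a → HasClassCount _~_ P b → a ≡ b
  classCount-unique ~-sym ~-trans C D =
    ≤-antisym (classCount-≤ ~-sym ~-trans C D) (classCount-≤ ~-sym ~-trans D C)

  classCount-resp : ∀ {Q : Pred A 0ℓ} → (∀ {x} → P x → Q x) → (∀ {x} → Q x → P x) →
    ∀ {n} → HasClassCount _~_ P n → HasClassCount _~_ Q n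
  classCount-resp P⇒Q Q⇒P (r , rP , r-inj , r-cover) =
    r , P⇒Q ∘ rP , r-inj , λ x Qx → r-cover x (Q⇒P Qx)

  classCount-restrict : ∀ {R : Pred A 0ℓ} {m k} (C : HasClassCount _~_ P m) →
    (∀ {x y} → x ~ y → P x → P y → R x → R y) →
    HasCount (R ∘ proj₁ C) k → HasClassCount _~_ (P ∩ R) k
  classCount-restrict {R} (r , rP , r-inj , r-cover) R-inv (f , fR , f-inj , f-cover) =
    r ∘ f , (λ j → rP (f j) , fR j) , (λ i j eq → f-inj i j (r-inj (f i) (f j) eq)) , cover
    where
    cover : ∀ x → (P ∩ R) x → ∃ λ j → x ~ r (f j)
    cover x (Px , Rx) with r-cover x Px
    ... | i , x~ri with f-cover i (R-inv x~ri Px (rP i) Rx)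
    ... | j , refl = j , x~ri

  classCount-split : Symmetric _~_ → ∀ {Q : Pred A 0ℓ} →
    (∀ {x} → P x → Dec (Q x)) → (∀ {x y} → x ~ y → P x → P y → Q x → Q y) →
    ∀ {m} → HasClassCount _~_ P m →
    ∃₂ λ k k′ → HasClassCount _~_ (P ∩ Q) k × HasClassCount _~_ (P ∩ ∁ Q) k′ × k + k′ ≡ m
  classCount-split ~-sym {Q} Q? Q-inv C@(r , rP , _) with count-split (λ i → Q? (rP i))
  ... | k , k′ , D , D′ , k+k′≡m =
    k , k′ , classCount-restrict C Q-inv D ,
    classCount-restrict C (λ x~y Px Py ¬Qx Qy → ¬Qx (Q-inv (~-sym x~y) Py Px Qy)) D′ , k+k′≡m

count-unique : ∀ {m} {P : Pred (Fin m) 0ℓ} {a b} → HasCount P a → HasCount P b → a ≡ b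
count-unique C D = classCount-unique {_~_ = _≡_} sym trans (asClassCount C) (asClassCount D)
  where
  asClassCount : ∀ {n} → HasCount _ n → HasClassCount _≡_ _ n
  asClassCount (f , fP , f-inj , f-cover) = f , fP , f-inj , λ x Px →
    let (i , fi≡x) = f-cover x Px in i , sym fi≡x

module _ {A : Set} {_~_ : A → A → Set} (~-equiv : IsEquivalence _~_) {P : Pred A 0ℓ} where
  open IsEquivalence ~-equiv renaming (refl to ~-refl; sym to ~-sym; trans to ~-trans)

  classCount-withRepresentative : ∀ {V x} → HasClassCount _~_ P V → P x →
    Σ (HasClassCount _~_ P V) λ C → ∃ λ i → proj₁ C i ≡ x
  classCount-withRepresentative {V} {x} (r , rP , r-inj , r-cover) Px =
    (r′ , r′P , (λ i j r′i~r′j → r-inj i j (~-trans (~-sym (r′~r i)) (~-trans r′i~r′j (r′~r j)))) ,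
     λ y Py → let (j , y~rj) = r-cover y Py in j , ~-trans y~rj (~-sym (r′~r j))) ,
    i₀ , r′i₀≡x
    where
    i₀ : Fin V
    i₀ = proj₁ (r-cover x Px)
    r′ : Fin V → A
    r′ i with i ≟ᶠ i₀
    ... | yes _ = x
    ... | no _ = r i
    r′P : ∀ i → P (r′ i)
    r′P i with i ≟ᶠ i₀
    ... | yes _ = Px
    ... | no _ = rP i
    r′~r : ∀ i → r′ i ~ r i
    r′~r i with i ≟ᶠ i₀
    ... | yes refl = proj₂ (r-cover x Px)
    ... | no _ = ~-refl
    r′i₀≡x : r′ i₀ ≡ x
    r′i₀≡x with i₀ ≟ᶠ i₀
    ... | yes _ = refl
    ... | no i₀≢i₀ = ⊥-elim (i₀≢i₀ refl)

module _ {N : ℕ} {_~_ : Fin N → Fin N → Set} (~-equiv : IsEquivalence _~_)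
  {τ : Fin N → Fin N} (τ~ : ∀ x → τ x ~ x) (τ-injective : ∀ {x y} → τ x ≡ τ y → x ≡ y)
  (τ-nofix : ∀ x → τ x ≢ x) (τ²-nofix : ∀ x → τ (τ x) ≢ x) where
  open IsEquivalence ~-equiv renaming (refl to ~-refl; sym to ~-sym; trans to ~-trans)

  private
    τ^ : Fin 3 → Fin N → Fin N
    τ^ zero x = x
    τ^ (suc zero) x = τ x
    τ^ (suc (suc zero)) x = τ (τ x)

    τ^~ : ∀ t x → τ^ t x ~ x
    τ^~ zero x = ~-refl
    τ^~ (suc zero) x = τ~ x
    τ^~ (suc (suc zero)) x = ~-trans (τ~ (τ x)) (τ~ x)

    τ^-injectiveˡ : ∀ t u x → τ^ t x ≡ τ^ u x → t ≡ u
    τ^-injectiveˡ zero zero x _ = refl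
    τ^-injectiveˡ zero (suc zero) x eq = ⊥-elim (τ-nofix x (sym eq))
    τ^-injectiveˡ zero (suc (suc zero)) x eq = ⊥-elim (τ²-nofix x (sym eq))
    τ^-injectiveˡ (suc zero) zero x eq = ⊥-elim (τ-nofix x eq)
    τ^-injectiveˡ (suc zero) (suc zero) x _ = refl
    τ^-injectiveˡ (suc zero) (suc (suc zero)) x eq = ⊥-elim (τ-nofix x (sym (τ-injective eq)))
    τ^-injectiveˡ (suc (suc zero)) zero x eq = ⊥-elim (τ²-nofix x eq)
    τ^-injectiveˡ (suc (suc zero)) (suc zero) x eq = ⊥-elim (τ-nofix x (τ-injective eq))
    τ^-injectiveˡ (suc (suc zero)) (suc (suc zero)) x _ = refl

    τ³≢τ^ : ∀ x → τ (τ (τ x)) ≢ x → ∀ t → τ (τ (τ x)) ≢ τ^ t x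
    τ³≢τ^ x τ³x≢x zero = τ³x≢x
    τ³≢τ^ x τ³x≢x (suc zero) eq = τ²-nofix x (τ-injective eq)
    τ³≢τ^ x τ³x≢x (suc (suc zero)) eq = τ-nofix x (τ-injective (τ-injective eq))

  -- Every class contains the three distinct points of a τ-orbit, so a class containing a
  -- fourth point τ³ x ≠ x would give more than 3 V points.
  τ³≡id : ∀ {V} → HasClassCount _~_ (λ _ → ⊤) V → N ≡ V * 3 → ∀ x → τ (τ (τ x)) ≡ x
  τ³≡id {V} C N≡3V x with τ (τ (τ x)) ≟ᶠ x | classCount-withRepresentative ~-equiv {x = x} C tt
  ... | yes τ³x≡x | _ = τ³x≡x
  ... | no τ³x≢x | (r , _ , r-inj , _) , i₀ , ri₀≡x =
    ⊥-elim (<-irrefl (sym N≡3V) (injective⇒≤ {f = F} (λ {j} {k} → F-injective j k)))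
    where
    G : Fin V × Fin 3 → Fin N
    G (i , t) = τ^ t (r i)
    G-injective : ∀ p p′ → G p ≡ G p′ → p ≡ p′
    G-injective (i , t) (i′ , t′) eq with r-inj i i′
      (~-trans (~-sym (τ^~ t (r i))) (subst (_~ r i′) (sym eq) (τ^~ t′ (r i′))))
    ... | refl = cong (i ,_) (τ^-injectiveˡ t t′ (r i) eq)
    extra≢G : ∀ p → τ (τ (τ x)) ≢ G p
    extra≢G (i , t) eq with r-inj i₀ i (subst (_~ r i) (sym ri₀≡x)
      (~-trans (~-sym (~-trans (τ^~ (suc (suc zero)) (τ x)) (τ~ x)))
               (subst (_~ r i) (sym eq) (τ^~ t (r i)))))
    ... | refl = τ³≢τ^ x τ³x≢x t (trans eq (cong (τ^ t) ri₀≡x))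
    F : Fin (suc (V * 3)) → Fin N
    F zero = τ (τ (τ x))
    F (suc j) = G (remQuot {V} 3 j)
    F-injective : ∀ j k → F j ≡ F k → j ≡ k
    F-injective zero zero _ = refl
    F-injective zero (suc k) eq = ⊥-elim (extra≢G (remQuot {V} 3 k) eq)
    F-injective (suc j) zero eq = ⊥-elim (extra≢G (remQuot {V} 3 j) (sym eq))
    F-injective (suc j) (suc k) eq = cong suc (begin
      j                                  ≡⟨ combine-remQuot {V} 3 j ⟨
      uncurry combine (remQuot {V} 3 j)  ≡⟨ cong (uncurry combine) (G-injective _ _ eq) ⟩
      uncurry combine (remQuot {V} 3 k)  ≡⟨ combine-remQuot {V} 3 k ⟩
      k                                  ∎)
      where open ≡-Reasoning

-- The automorphism group is cyclic

module SubgroupOfℤ {N : ℕ} .{{N≢0 : NonZero N}} {P : Pred ℕ 0ℓ}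
  (P-0 : P 0) (P-N : P N)
  (P-+ : ∀ {a b} → P a → P b → P (a + b)) (P-∸ : ∀ {a b} → P (a + b) → P b → P a)
  where

  P-* : ∀ t {a} → P a → P (t * a)
  P-* zero Pa = P-0
  P-* (suc t) Pa = P-+ Pa (P-* t Pa)

  P-gcd : ∀ {a b} → P a → P b → P (gcd a b)
  P-gcd {a} {b} Pa Pb with Bézout.identity (gcd-GCD a b)
  ... | Bézout.+- x y d+yb≡xa = P-∸ (subst P (sym d+yb≡xa) (P-* x Pa)) (P-* y Pb)
  ... | Bézout.-+ x y d+xa≡yb = P-∸ (subst P (sym d+xa≡yb) (P-* y Pb)) (P-* x Pa)

  gcdWithN : ∀ {a} → (Fin a → ℕ) → ℕ
  gcdWithN = foldr gcd N

  P-gcdWithN : ∀ {a} (h : Fin a → ℕ) → (∀ i → P (h i)) → P (gcdWithN h)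
  P-gcdWithN {zero} h Ph = P-N
  P-gcdWithN {suc a} h Ph = P-gcd (Ph zero) (P-gcdWithN (h ∘ suc) (Ph ∘ suc))

  gcdWithN∣N : ∀ {a} (h : Fin a → ℕ) → gcdWithN h ∣ N
  gcdWithN∣N {zero} h = ∣-refl
  gcdWithN∣N {suc a} h = ∣-trans (gcd[m,n]∣n (h zero) _) (gcdWithN∣N (h ∘ suc))

  gcdWithN∣h : ∀ {a} (h : Fin a → ℕ) i → gcdWithN h ∣ h i
  gcdWithN∣h h zero = gcd[m,n]∣m (h zero) _
  gcdWithN∣h h (suc i) = ∣-trans (gcd[m,n]∣n (h zero) _) (gcdWithN∣h (h ∘ suc) i)

  multiples-count : ∀ {d q} → N ≡ q * d → P d → (∀ k → P (toℕ k) → d ∣ toℕ k) →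
    HasCount (P ∘ toℕ {N}) q
  multiples-count {d} {q} N≡qd Pd d∣P =
    E , (λ j → subst P (sym (toℕ-E j)) (P-* (toℕ j) Pd)) , E-injective , cover
    where
    instance
      d≢0 : NonZero d
      d≢0 = m*n≢0⇒n≢0 q {{subst NonZero N≡qd N≢0}}
    jd<N : ∀ {j} → j < q → j * d < N
    jd<N {j} j<q = subst (j * d <_) (sym N≡qd) (*-monoˡ-< d j<q)
    E : Fin q → Fin N
    E j = fromℕ< (jd<N (toℕ<n j))
    toℕ-E : ∀ j → toℕ (E j) ≡ toℕ j * d
    toℕ-E j = toℕ-fromℕ< (jd<N (toℕ<n j))
    E-injective : ∀ i j → E i ≡ E j → i ≡ j
    E-injective i j eq = toℕ-injective (*-cancelʳ-≡ (toℕ i) (toℕ j) d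
      (trans (sym (toℕ-E i)) (trans (cong toℕ eq) (toℕ-E j))))
    cover : ∀ k → P (toℕ k) → ∃ λ j → E j ≡ k
    cover k Pk with d∣P k Pk
    ... | divides t k≡td = fromℕ< t<q , toℕ-injective (begin
          toℕ (E (fromℕ< t<q))   ≡⟨ toℕ-E (fromℕ< t<q) ⟩
          toℕ (fromℕ< t<q) * d   ≡⟨ cong (_* d) (toℕ-fromℕ< t<q) ⟩
          t * d                  ≡⟨ k≡td ⟨
          toℕ k                  ∎)
      where
      open ≡-Reasoning
      t<q : t < q
      t<q = *-cancelʳ-< d t q (subst₂ _<_ k≡td N≡qd (toℕ<n k))

  -- P consists of the multiples of the gcd of N and the elements of P below N.
  generator : ∀ {a} → HasCount (P ∘ toℕ {N}) a → ∃ λ d → P d × a * d ≡ N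
  generator C@(f , Pf , _ , f-cover) =
    d , Pd , trans (cong (_* d) (count-unique {P = P ∘ toℕ} C (multiples-count {d} {q} N≡qd Pd d∣P))) (sym N≡qd)
    where
    d : ℕ
    d = gcdWithN (toℕ ∘ f)
    Pd : P d
    Pd = P-gcdWithN (toℕ ∘ f) Pf
    q : ℕ
    q = quotient (gcdWithN∣N (toℕ ∘ f))
    N≡qd : N ≡ q * d
    N≡qd = _∣_.equality (gcdWithN∣N (toℕ ∘ f))
    d∣P : ∀ k → P (toℕ k) → d ∣ toℕ k
    d∣P k Pk with f-cover k Pk
    ... | i , refl = gcdWithN∣h (toℕ ∘ f) i

-- IsAut w k unfolds to IsAutShift w (toℕ k).
IsAutShift : ∀ {e} → Word (suc e) → ℕ → Set
IsAutShift {e} w a = Σ (Letter (suc e) → Letter (suc e)) λ φ → IsRelabeling φ × (∀ i → w (i ⊕ a) ≡ φ (w i))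

module _ {e : ℕ} {w : Word (suc e)} where
  open Modulo (2 * suc e) using (_≈_)

  IsAutShift-cong : ∀ {a b} → a ≈ b → IsAutShift w a → IsAutShift w b
  IsAutShift-cong a≈b (φ , R , w⊕a) = φ , R , λ i → trans (cong w (⊕-congʳ i (sym a≈b))) (w⊕a i)

  IsAutShift-0 : IsAutShift w 0
  IsAutShift-0 = id , id-isRelabeling , λ i → cong w (⊕-identityʳ i)

  IsAutShift-N : IsAutShift w (2 * suc e)
  IsAutShift-N = IsAutShift-cong (sym (n%n≡0 (2 * suc e))) IsAutShift-0

  IsAutShift-+ : ∀ {a b} → IsAutShift w a → IsAutShift w b → IsAutShift w (a + b)
  IsAutShift-+ {a} {b} (φ , R , w⊕a) (ψ , S , w⊕b) = ψ ∘ φ , ∘-isRelabeling S R , λ i → begin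
    w (i ⊕ (a + b))  ≡⟨ cong w (⊕-assoc i a b) ⟨
    w (i ⊕ a ⊕ b)    ≡⟨ w⊕b (i ⊕ a) ⟩
    ψ (w (i ⊕ a))    ≡⟨ cong ψ (w⊕a i) ⟩
    ψ (φ (w i))      ∎
    where open ≡-Reasoning

  IsAutShift-∸ : ∀ {a b} → IsAutShift w (a + b) → IsAutShift w b → IsAutShift w a
  IsAutShift-∸ {a} {b} (φ , R , w⊕a+b) (ψ , S , w⊕b) =
    relabeling⁻¹ S ∘ φ , ∘-isRelabeling (⁻¹-isRelabeling S) R , λ i → begin
      w (i ⊕ a)                         ≡⟨ relabeling⁻¹-φ S _ ⟨
      relabeling⁻¹ S (ψ (w (i ⊕ a)))    ≡⟨ cong (relabeling⁻¹ S) (w⊕b (i ⊕ a)) ⟨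
      relabeling⁻¹ S (w (i ⊕ a ⊕ b))    ≡⟨ cong (relabeling⁻¹ S ∘ w) (⊕-assoc i a b) ⟩
      relabeling⁻¹ S (w (i ⊕ (a + b)))  ≡⟨ cong (relabeling⁻¹ S) (w⊕a+b i) ⟩
      relabeling⁻¹ S (φ (w i))          ∎
    where open ≡-Reasoning

  private
    module AutShifts = SubgroupOfℤ {P = IsAutShift w} IsAutShift-0 IsAutShift-N IsAutShift-+ IsAutShift-∸

  IsAutShift-* : ∀ t {a} → IsAutShift w a → IsAutShift w (t * a)
  IsAutShift-* = AutShifts.P-*

  autOrder-generator : ∀ {a} → AutOrder w a → ∃ λ m → IsAutShift w m × a * m ≡ 2 * suc e
  autOrder-generator = AutShifts.generator

-- Corners and vertices

inv-involutive : ∀ {e} (x : Letter e) → inv (inv x) ≡ x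
inv-involutive (a , b) = cong (a ,_) (not-involutive b)

InversePairing : ∀ {e} → Word e → Set
InversePairing {e} w =
  ∀ i → Σ (Fin (2 * e)) λ j → (w j ≡ inv (w i)) × (∀ j′ → w j′ ≡ inv (w i) → j′ ≡ j)

module Corners {e : ℕ} {w : Word (suc e)} (pairing : InversePairing w) where

  π : Fin (2 * suc e) → Fin (2 * suc e)
  π i = proj₁ (pairing i)

  w-π : ∀ i → w (π i) ≡ inv (w i)
  w-π i = proj₁ (proj₂ (pairing i))

  π-unique : ∀ {i j} → w j ≡ inv (w i) → j ≡ π i
  π-unique {i} {j} = proj₂ (proj₂ (pairing i)) j

  w-π⁻¹ : ∀ i → w i ≡ inv (w (π i))
  w-π⁻¹ i = trans (sym (inv-involutive (w i))) (cong inv (sym (w-π i)))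

  π-involutive : ∀ i → π (π i) ≡ i
  π-involutive i = sym (π-unique (w-π⁻¹ i))

  π-injective : ∀ {i j} → π i ≡ π j → i ≡ j
  π-injective {i} {j} eq = trans (sym (π-involutive i)) (trans (cong π eq) (π-involutive j))

  -- Gluing w_{π x} to w_x identifies corner σ x with corner x.
  σ : Fin (2 * suc e) → Fin (2 * suc e)
  σ x = π x ⊕ 1

  σ-π : ∀ i → σ (π i) ≡ i ⊕ 1
  σ-π i = cong (_⊕ 1) (π-involutive i)

  σ-injective : ∀ {x y} → σ x ≡ σ y → x ≡ y
  σ-injective eq = π-injective (⊕-injective 1 eq)

  σ-cornerEq : ∀ x → CornerEq w (σ x) x
  σ-cornerEq x = glue (w-π⁻¹ x)

  π-⊕ : ∀ {a} → IsAutShift w a → ∀ x → π (x ⊕ a) ≡ π x ⊕ a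
  π-⊕ {a} (φ , (_ , φ-inv) , w⊕a) x = sym (π-unique (begin
    w (π x ⊕ a)        ≡⟨ w⊕a (π x) ⟩
    φ (w (π x))        ≡⟨ cong φ (w-π x) ⟩
    φ (inv (w x))      ≡⟨ φ-inv (w x) ⟩
    inv (φ (w x))      ≡⟨ cong inv (w⊕a x) ⟨
    inv (w (x ⊕ a))    ∎))
    where open ≡-Reasoning

  σ-⊕ : ∀ {a} → IsAutShift w a → ∀ x → σ (x ⊕ a) ≡ σ x ⊕ a
  σ-⊕ A x = trans (cong (_⊕ 1) (π-⊕ A x)) (⊕-comm (π x) _ 1)

  σ-nofix : (∀ i → ¬ (w (next i) ≡ inv (w i))) → ∀ x → σ x ≢ x
  σ-nofix no-xx⁻¹ x σx≡x = no-xx⁻¹ (π x) (trans (cong w σx≡x) (w-π⁻¹ x))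

  σ²-nofix : (∀ i j → ¬ ((w j ≡ inv (w (next i))) × (w (next j) ≡ inv (w i)))) → ∀ x → σ (σ x) ≢ x
  σ²-nofix no-xy-y⁻¹x⁻¹ x σσx≡x =
    no-xy-y⁻¹x⁻¹ (π (σ x)) (π x) (trans (w-π x) (cong (inv ∘ w) (sym σσx≡x)) , w-π⁻¹ (σ x))

  module ShiftOrder (σ³≡id : ∀ x → σ (σ (σ x)) ≡ x)
    {m q : ℕ} (shift-m : IsAutShift w m) (q*m≡N : q * m ≡ 2 * suc e) where

    private
      N : ℕ
      N = 2 * suc e

    instance
      m≢0 : NonZero m
      m≢0 = m*n≢0⇒n≢0 q {{subst NonZero (sym q*m≡N) _}}
      q≢0 : NonZero q
      q≢0 = m*n≢0⇒m≢0 q {{subst NonZero (sym q*m≡N) _}}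
      q*m≢0 : NonZero (q * m)
      q*m≢0 = m*n≢0 q m

    open Modulo q
    open import Algebra.Properties.CommutativeMonoid.Sum +-commutativeMonoid
      using (sum-syntax; sum-cong-≋; sum-cong-≗; ∑-distrib-+; ∑-permute)
    module ≈-Reasoning = Relation.Binary.Reasoning.Setoid (CommutativeMonoid.setoid +-commutativeMonoid)
    open import Algebra.Properties.CommutativeSemigroup (CommutativeMonoid.commutativeSemigroup +-commutativeMonoid)
      using (xy∙z≈xz∙y)

    m∣N : m ∣ N
    m∣N = divides q (sym q*m≡N)

    level : Fin N → ℕ
    level x = toℕ x / m

    residue : Fin N → Fin m
    residue x = toℕ x mod m

    ι : Fin m → Fin N
    ι i = pos (toℕ i)

    toℕ-ι : ∀ i → toℕ (ι i) ≡ toℕ i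
    toℕ-ι i = trans (toℕ-pos (toℕ i)) (m<n⇒m%n≡m (<-≤-trans (toℕ<n i) (∣⇒≤ m∣N)))

    toℕ-residue : ∀ x → toℕ (residue x) ≡ toℕ x % m
    toℕ-residue x = toℕ-fromℕ< (m%n<n (toℕ x) m)

    residue-ι : ∀ i → residue (ι i) ≡ i
    residue-ι i = toℕ-injective (begin
      toℕ (residue (ι i))  ≡⟨ toℕ-residue (ι i) ⟩
      toℕ (ι i) % m        ≡⟨ cong (_% m) (toℕ-ι i) ⟩
      toℕ i % m            ≡⟨ m<n⇒m%n≡m (toℕ<n i) ⟩
      toℕ i                ∎)
      where open ≡-Reasoning

    ι-residue-⊕ : ∀ x → ι (residue x) ⊕ level x * m ≡ x
    ι-residue-⊕ x = begin
      pos (toℕ (ι (residue x)) + level x * m)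
        ≡⟨ cong (λ r → pos (r + level x * m)) (trans (toℕ-ι _) (toℕ-residue x)) ⟩
      pos (toℕ x % m + toℕ x / m * m)          ≡⟨ cong pos (m≡m%n+[m/n]*n (toℕ x) m) ⟨
      pos (toℕ x)                              ≡⟨ pos-toℕ x ⟩
      x                                        ∎
      where open ≡-Reasoning

    residue-⊕ : ∀ x t → residue (x ⊕ t * m) ≡ residue x
    residue-⊕ x t = toℕ-injective (begin
      toℕ (residue (x ⊕ t * m))        ≡⟨ toℕ-residue (x ⊕ t * m) ⟩
      toℕ (x ⊕ t * m) % m              ≡⟨ cong (_% m) (toℕ-pos (toℕ x + t * m)) ⟩
      (toℕ x + t * m) % N % m          ≡⟨ m∣n⇒o%n%m≡o%m m N (toℕ x + t * m) m∣N ⟩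
      (toℕ x + t * m) % m              ≡⟨ [m+kn]%n≡m%n (toℕ x) t m ⟩
      toℕ x % m                        ≡⟨ toℕ-residue x ⟨
      toℕ (residue x)                  ∎)
      where open ≡-Reasoning

    level-⊕ : ∀ x t → level (x ⊕ t * m) ≈ level x + t
    level-⊕ x t = begin
      toℕ (x ⊕ t * m) / m % q            ≡⟨ cong (λ r → r / m % q) (toℕ-pos (toℕ x + t * m)) ⟩
      (toℕ x + t * m) % N / m % q        ≡⟨ cong (λ r → r / m % q) (%-congʳ (sym q*m≡N)) ⟩
      (toℕ x + t * m) % (q * m) / m % q  ≡⟨ cong (_% q) (m%[n*o]/o≡m/o%n (toℕ x + t * m) q m) ⟩
      (toℕ x + t * m) / m % q % q        ≡⟨ m%n%n≡m%n _ q ⟩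
      (toℕ x + t * m) / m % q            ≡⟨ cong (_% q) (+-distrib-/-∣ʳ (toℕ x) (divides t refl)) ⟩
      (level x + t * m / m) % q          ≡⟨ cong (λ r → (level x + r) % q) (m*n/n≡m t m) ⟩
      (level x + t) % q                  ∎
      where open ≡-Reasoning

    shift-tm : ∀ t → IsAutShift w (t * m)
    shift-tm t = IsAutShift-* t shift-m

    h : Fin N → ℕ
    h x = level x + level (σ x) + level (σ (σ x))

    h-σ : ∀ x → h (σ x) ≡ h x
    h-σ x = begin
      level (σ x) + level (σ (σ x)) + level (σ (σ (σ x)))
        ≡⟨ cong (λ y → level (σ x) + level (σ (σ x)) + level y) (σ³≡id x) ⟩
      level (σ x) + level (σ (σ x)) + level x              ≡⟨ +-comm _ (level x) ⟩
      level x + (level (σ x) + level (σ (σ x)))            ≡⟨ +-assoc (level x) _ _ ⟨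
      h x                                                  ∎
      where open ≡-Reasoning

    h-⊕ : ∀ x t → h (x ⊕ t * m) ≈ h x + 3 * t
    h-⊕ x t = begin
      h (x ⊕ t * m)
        ≡⟨ cong₂ (λ y z → level (x ⊕ t * m) + level y + level z) σ-x⊕ σσ-x⊕ ⟩
      level (x ⊕ t * m) + level (σ x ⊕ t * m) + level (σ (σ x) ⊕ t * m)
        ≈⟨ +-cong (+-cong (level-⊕ x t) (level-⊕ (σ x) t)) (level-⊕ (σ (σ x)) t) ⟩
      (level x + t) + (level (σ x) + t) + (level (σ (σ x)) + t)
        ≡⟨ regroup (level x) (level (σ x)) (level (σ (σ x))) t ⟩
      h x + 3 * t
        ∎
      where
      open ≈-Reasoning
      σ-x⊕ : σ (x ⊕ t * m) ≡ σ x ⊕ t * m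
      σ-x⊕ = σ-⊕ (shift-tm t) x
      σσ-x⊕ : σ (σ (x ⊕ t * m)) ≡ σ (σ x) ⊕ t * m
      σσ-x⊕ = trans (cong σ σ-x⊕) (σ-⊕ (shift-tm t) (σ x))
      regroup : ∀ a b c t → (a + t) + (b + t) + (c + t) ≡ a + b + c + 3 * t
      regroup = solve-∀

    -- π descends to an involution π̄ of the fundamental domain Fin m of the shift by m.
    π̄ : Fin m → Fin m
    π̄ i = residue (π (ι i))

    π-level : Fin m → ℕ
    π-level i = level (π (ι i))

    π-ι : ∀ i → π (ι i) ≡ ι (π̄ i) ⊕ π-level i * m
    π-ι i = sym (ι-residue-⊕ (π (ι i)))

    π̄-involutive : ∀ i → π̄ (π̄ i) ≡ i
    π̄-involutive i = begin
      residue (π (ι (π̄ i)))                     ≡⟨ residue-⊕ _ (π-level i) ⟨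
      residue (π (ι (π̄ i)) ⊕ π-level i * m)     ≡⟨ cong residue (π-⊕ (shift-tm (π-level i)) (ι (π̄ i))) ⟨
      residue (π (ι (π̄ i) ⊕ π-level i * m))     ≡⟨ cong (residue ∘ π) (π-ι i) ⟨
      residue (π (π (ι i)))                     ≡⟨ cong residue (π-involutive (ι i)) ⟩
      residue (ι i)                             ≡⟨ residue-ι i ⟩
      i                                         ∎
      where open ≡-Reasoning

    h-head-π̄ : ∀ i → h (ι (π̄ i) ⊕ 1) + 3 * π-level i ≈ h (ι i)
    h-head-π̄ i = begin
      h (ι (π̄ i) ⊕ 1) + 3 * π-level i    ≈⟨ h-⊕ (ι (π̄ i) ⊕ 1) (π-level i) ⟨
      h (ι (π̄ i) ⊕ 1 ⊕ π-level i * m)    ≡⟨ cong h (⊕-comm (ι (π̄ i)) 1 _) ⟩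
      h (ι (π̄ i) ⊕ π-level i * m ⊕ 1)    ≡⟨ cong (λ y → h (y ⊕ 1)) (π-ι i) ⟨
      h (σ (ι i))                         ≡⟨ h-σ (ι i) ⟩
      h (ι i)                             ∎
      where open ≈-Reasoning

    h-tail-π̄ : ∀ i → h (ι (π̄ i)) + 3 * π-level i ≈ h (ι i ⊕ 1)
    h-tail-π̄ i = begin
      h (ι (π̄ i)) + 3 * π-level i    ≈⟨ h-⊕ (ι (π̄ i)) (π-level i) ⟨
      h (ι (π̄ i) ⊕ π-level i * m)    ≡⟨ cong h (π-ι i) ⟨
      h (π (ι i))                    ≡⟨ h-σ (π (ι i)) ⟨
      h (σ (π (ι i)))                ≡⟨ cong h (σ-π (ι i)) ⟩
      h (ι i ⊕ 1)                    ∎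
      where open ≈-Reasoning

    ∑-pair : ∀ (f c g : Fin m → ℕ) → (∀ i → f (π̄ i) + c i ≈ g i) →
      ∑[ i < m ] f i + ∑[ i < m ] c i ≈ ∑[ i < m ] g i
    ∑-pair f c g f∘π̄+c≈g = begin
      ∑[ i < m ] f i + ∑[ i < m ] c i
        ≈⟨ +-cong (∑-permute f (permutation π̄ π̄ π̄-involutive π̄-involutive)) refl ⟩
      ∑[ i < m ] f (π̄ i) + ∑[ i < m ] c i      ≈⟨ ∑-distrib-+ (f ∘ π̄) c ⟨
      ∑[ i < m ] (f (π̄ i) + c i)                ≈⟨ sum-cong-≋ f∘π̄+c≈g ⟩
      ∑[ i < m ] g i                            ∎
      where open ≈-Reasoning

    ∑h ∑h⁺ ∑ℓ H₀ : ℕ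
    ∑h = ∑[ i < m ] h (ι i)
    ∑h⁺ = ∑[ i < m ] h (ι i ⊕ 1)
    ∑ℓ = ∑[ i < m ] (3 * π-level i)
    H₀ = h (pos 0)

    ∑h⁺+∑ℓ≈∑h : ∑h⁺ + ∑ℓ ≈ ∑h
    ∑h⁺+∑ℓ≈∑h = ∑-pair (λ i → h (ι i ⊕ 1)) (λ i → 3 * π-level i) (h ∘ ι) h-head-π̄

    ∑h+∑ℓ≈∑h⁺ : ∑h + ∑ℓ ≈ ∑h⁺
    ∑h+∑ℓ≈∑h⁺ = ∑-pair (h ∘ ι) (λ i → 3 * π-level i) (λ i → h (ι i ⊕ 1)) h-tail-π̄

    ∑h⁺+H₀≈∑h+H₀+3 : ∑h⁺ + H₀ ≈ ∑h + H₀ + 3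
    ∑h⁺+H₀≈∑h+H₀+3 = begin
      ∑h⁺ + H₀
        ≡⟨ cong (_+ H₀) (sum-cong-≗ {m} λ i → cong h (trans (pos-⊕ (toℕ i) 1) (cong pos (+-comm (toℕ i) 1)))) ⟩
      ∑[ i < m ] h (pos (suc (toℕ i))) + H₀
        ≡⟨ ∑-telescope m (h ∘ pos) ⟩
      ∑h + h (pos m)
        ≡⟨ cong (λ k → ∑h + h k) (trans (pos-⊕ 0 (1 * m)) (cong pos (*-identityˡ m))) ⟨
      ∑h + h (pos 0 ⊕ 1 * m)
        ≈⟨ +-cong {∑h} refl (h-⊕ (pos 0) 1) ⟩
      ∑h + (H₀ + 3)
        ≡⟨ +-assoc ∑h H₀ 3 ⟨
      ∑h + H₀ + 3
        ∎
      where open ≈-Reasoning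

    ∑h+H₀+∑ℓ≈∑h+H₀+3 : ∑h + H₀ + ∑ℓ ≈ ∑h + H₀ + 3
    ∑h+H₀+∑ℓ≈∑h+H₀+3 = begin
      ∑h + H₀ + ∑ℓ    ≈⟨ xy∙z≈xz∙y ∑h H₀ ∑ℓ ⟩
      ∑h + ∑ℓ + H₀    ≈⟨ +-cong ∑h+∑ℓ≈∑h⁺ refl ⟩
      ∑h⁺ + H₀        ≈⟨ ∑h⁺+H₀≈∑h+H₀+3 ⟩
      ∑h + H₀ + 3     ∎
      where open ≈-Reasoning

    q∣6 : q ∣ 6
    q∣6 = m+n≈m⇒q∣n (∑h + H₀) (begin
      ∑h + H₀ + 6                ≡⟨ +-assoc (∑h + H₀) 3 3 ⟨
      ∑h + H₀ + 3 + 3            ≈⟨ +-cong ∑h+H₀+∑ℓ≈∑h+H₀+3 refl ⟨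
      ∑h + H₀ + ∑ℓ + 3           ≈⟨ xy∙z≈xz∙y (∑h + H₀) ∑ℓ 3 ⟩
      ∑h + H₀ + 3 + ∑ℓ           ≈⟨ +-cong ∑h⁺+H₀≈∑h+H₀+3 refl ⟨
      ∑h⁺ + H₀ + ∑ℓ              ≈⟨ xy∙z≈xz∙y ∑h⁺ H₀ ∑ℓ ⟩
      ∑h⁺ + ∑ℓ + H₀              ≈⟨ +-cong ∑h⁺+∑ℓ≈∑h refl ⟩
      ∑h + H₀                    ∎)
      where open ≈-Reasoning

CornerEq-isEquivalence : ∀ {e} {w : Word e} → IsEquivalence (CornerEq w)
CornerEq-isEquivalence = record { refl = c-refl ; sym = c-sym ; trans = c-trans }

module _ {e : ℕ} {w : Word (suc e)} (W : IsWicks w) where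
  open Corners (proj₁ (proj₂ W))

  wicks-σ³≡id : ∀ {V} → NumVertices w V → 2 * suc e ≡ V * 3 → ∀ x → σ (σ (σ x)) ≡ x
  wicks-σ³≡id = τ³≡id CornerEq-isEquivalence σ-cornerEq σ-injective
    (σ-nofix (proj₁ (proj₂ (proj₂ W)))) (σ²-nofix (proj₂ (proj₂ (proj₂ W))))

wicks-autOrder∣6 : ∀ {e} {w : Word e} → 0 < e → IsWicks w → ∀ {V} → NumVertices w V → 2 * e ≡ V * 3 →
  ∀ {a} → AutOrder w a → a ∣ 6
wicks-autOrder∣6 {zero} ()
wicks-autOrder∣6 {suc e} _ W vertices 2e≡3V aut =
  let (m , shift-m , a*m≡2e) = autOrder-generator aut
  in Corners.ShiftOrder.q∣6 (proj₁ (proj₂ W)) (wicks-σ³≡id W vertices 2e≡3V) shift-m a*m≡2e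

maxE-vertices : ∀ {g} → g ≥ 1 → ∀ {V} → V + 2 * g ≡ maxE g + 1 → 0 < maxE g × 2 * maxE g ≡ V * 3
maxE-vertices {suc g} _ {V} V+2g≡e+1 =
  <-≤-trans 0<k (m≤n*m k 3) , trans (2[3k]≡2k*3 k) (cong (_* 3) (sym V≡2k))
  where
  -- 2 * suc g reduces to suc k, so the genus equation reads V + suc k ≡ 3 * k + 1.
  k : ℕ
  k = 2 * suc g ∸ 1
  0<k : 0 < k
  0<k = <-≤-trans (s≤s z≤n) (m≤n+m (suc (g + 0)) g)
  V≡2k : V ≡ 2 * k
  V≡2k = +-cancelʳ-≡ (suc k) V (2 * k) (trans V+2g≡e+1 (3k+1≡2k+[1+k] k))
    where
    3k+1≡2k+[1+k] : ∀ k → 3 * k + 1 ≡ 2 * k + suc k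
    3k+1≡2k+[1+k] = solve-∀
  2[3k]≡2k*3 : ∀ k → 2 * (3 * k) ≡ 2 * k * 3
  2[3k]≡2k*3 = solve-∀

maxForm-autOrder∣6 : ∀ {g} → g ≥ 1 → ∀ {w} → IsMaxForm g w → ∀ {a} → AutOrder w a → a ∣ 6
maxForm-autOrder∣6 g≥1 (W , V , vertices , V+2g≡e+1) =
  let (0<e , 2e≡3V) = maxE-vertices g≥1 {V} V+2g≡e+1 in wicks-autOrder∣6 0<e W vertices 2e≡3V

-- Counting classes of maximal forms

divisorsOf6 : List ℕ
divisorsOf6 = 1 ∷ 2 ∷ 3 ∷ 6 ∷ []

∣6⇒∈divisorsOf6 : ∀ {a} → a ∣ 6 → a ∈ divisorsOf6
∣6⇒∈divisorsOf6 {0} 0∣6 = contradiction 0∣6 (from-no (0 ∣? 6))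
∣6⇒∈divisorsOf6 {1} _ = here refl
∣6⇒∈divisorsOf6 {2} _ = there (here refl)
∣6⇒∈divisorsOf6 {3} _ = there (there (here refl))
∣6⇒∈divisorsOf6 {4} 4∣6 = contradiction 4∣6 (from-no (4 ∣? 6))
∣6⇒∈divisorsOf6 {5} 5∣6 = contradiction 5∣6 (from-no (5 ∣? 6))
∣6⇒∈divisorsOf6 {6} _ = there (there (there (here refl)))
∣6⇒∈divisorsOf6 {suc (suc (suc (suc (suc (suc (suc a))))))} a∣6 =
  contradiction (∣⇒≤ a∣6) (from-no (7 + a ≤? 6))

SameOnDivisorsOf6 : ∀ {T T′ : Pred ℕ 0ℓ} → Decidable T → Decidable T′ → Set
SameOnDivisorsOf6 T? T′? = map (does ∘ T?) divisorsOf6 ≡ map (does ∘ T′?) divisorsOf6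

SameOnDivisorsOf6⇒ : ∀ {T T′ : Pred ℕ 0ℓ} (T? : Decidable T) (T′? : Decidable T′) →
  SameOnDivisorsOf6 T? T′? → ∀ {a} → a ∣ 6 → T a → T′ a
SameOnDivisorsOf6⇒ T? T′? same a∣6 =
  does-≡⇒ (T? _) (T′? _) (map-≡⇒≡ {does ∘ T?} {does ∘ T′?} same (∣6⇒∈divisorsOf6 a∣6))
  where
  map-≡⇒≡ : ∀ {f f′ : ℕ → Bool} {xs a} → map f xs ≡ map f′ xs → a ∈ xs → f a ≡ f′ a
  map-≡⇒≡ eq (here refl) = proj₁ (∷-injective eq)
  map-≡⇒≡ eq (there a∈xs) = map-≡⇒≡ (proj₂ (∷-injective eq)) a∈xs
  does-≡⇒ : ∀ {A B : Set} (A? : Dec A) (B? : Dec B) → does A? ≡ does B? → A → B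
  does-≡⇒ (yes _) (yes b) _ _ = b
  does-≡⇒ (no ¬a) _ _ a = ⊥-elim (¬a a)

module MaxFormClasses (g : ℕ) where

  OrderSatisfies : Pred ℕ 0ℓ → Word (maxE g) → Set
  OrderSatisfies T w = ∃ λ a → AutOrder w a × T a

  autOrder-unique : ∀ {w : Word (maxE g)} {a b} → AutOrder w a → AutOrder w b → a ≡ b
  autOrder-unique = count-unique

  OrderSatisfies⇒ : ∀ {U w a} → AutOrder w a → OrderSatisfies U w → U a
  OrderSatisfies⇒ {U} aut (b , aut′ , Ub) = subst U (autOrder-unique aut′ aut) Ub

  OrderSatisfies-transport : ∀ {T u v} → Equiv u v → OrderSatisfies T u → OrderSatisfies T v
  OrderSatisfies-transport u~v (a , (f , fAut , f-inj , f-cover) , Ta) =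
    a , (f , IsAut-transport u~v ∘ fAut , f-inj , λ k → f-cover k ∘ IsAut-transport (Equiv-sym u~v)) , Ta

  maxClasses-resp : ∀ {T T′} → (∀ {w a} → IsMaxForm g w → AutOrder w a → T a → T′ a) →
    (∀ {w a} → IsMaxForm g w → AutOrder w a → T′ a → T a) →
    ∀ {n} → NumMaxClasses g (OrderSatisfies T) n → NumMaxClasses g (OrderSatisfies T′) n
  maxClasses-resp T⇒T′ T′⇒T = classCount-resp {_~_ = Equiv}
    (λ (max , a , aut , Ta) → max , a , aut , T⇒T′ max aut Ta)
    (λ (max , a , aut , T′a) → max , a , aut , T′⇒T max aut T′a)

  OrderSatisfies? : ∀ {U} → Decidable U → ∀ {T w} → (IsMaxForm g ∩ OrderSatisfies T) w → Dec (OrderSatisfies U w)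
  OrderSatisfies? {U} U? (_ , a , aut , _) with U? a
  ... | yes Ua = yes (a , aut , Ua)
  ... | no ¬Ua = no (¬Ua ∘ OrderSatisfies⇒ aut)

  maxClasses-split : ∀ {T U} → Decidable U → ∀ {m} → NumMaxClasses g (OrderSatisfies T) m →
    ∃₂ λ k k′ → NumMaxClasses g (OrderSatisfies (T ∩ U)) k ×
                NumMaxClasses g (OrderSatisfies (T ∩ ∁ U)) k′ × k + k′ ≡ m
  maxClasses-split {T} {U} U? C
    with classCount-split {_~_ = Equiv} {P = IsMaxForm g ∩ OrderSatisfies T} Equiv-sym
           {Q = OrderSatisfies U} (OrderSatisfies? U?) (λ u~v _ _ → OrderSatisfies-transport u~v) C
  ... | k , k′ , C∩ , C∖ , k+k′≡m =
    k , k′ ,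
    classCount-resp {_~_ = Equiv}
      (λ ((max , a , aut , Ta) , Uw) → max , a , aut , Ta , OrderSatisfies⇒ aut Uw)
      (λ (max , a , aut , Ta , Ua) → (max , a , aut , Ta) , (a , aut , Ua)) C∩ ,
    classCount-resp {_~_ = Equiv}
      (λ ((max , a , aut , Ta) , ¬Uw) → max , a , aut , Ta , λ Ua → ¬Uw (a , aut , Ua))
      (λ (max , a , aut , Ta , ¬Ua) → (max , a , aut , Ta) , ¬Ua ∘ OrderSatisfies⇒ aut) C∖ ,
    k+k′≡m

  OrderSatisfies-≡ : ∀ {a n} → NumMaxClasses g (OrderSatisfies (_≡ a)) n → NumMaxClasses g (λ w → AutOrder w a) n
  OrderSatisfies-≡ = classCount-resp {_~_ = Equiv}
    (λ { (max , _ , aut , refl) → max , aut }) (λ (max , aut) → max , _ , aut , refl)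

  module _ (g≥1 : g ≥ 1) where

    maxClasses-cong : ∀ {T T′} (T? : Decidable T) (T′? : Decidable T′) → SameOnDivisorsOf6 T? T′? →
      ∀ {n} → NumMaxClasses g (OrderSatisfies T) n → NumMaxClasses g (OrderSatisfies T′) n
    maxClasses-cong T? T′? same = maxClasses-resp
      (λ max aut → SameOnDivisorsOf6⇒ T? T′? same (maxForm-autOrder∣6 g≥1 max aut))
      (λ max aut → SameOnDivisorsOf6⇒ T′? T? (sym same) (maxForm-autOrder∣6 g≥1 max aut))

    maxClasses-splitOff : ∀ {T U T₁ T₂}
      (T? : Decidable T) (U? : Decidable U) (T₁? : Decidable T₁) (T₂? : Decidable T₂) →
      SameOnDivisorsOf6 (T? ∩? U?) T₁? → SameOnDivisorsOf6 (T? ∩? ∁? U?) T₂? →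
      ∀ {m m₁} → NumMaxClasses g (OrderSatisfies T) m → NumMaxClasses g (OrderSatisfies T₁) m₁ →
      ∃ λ n → NumMaxClasses g (OrderSatisfies T₂) n × m₁ + n ≡ m
    maxClasses-splitOff T? U? T₁? T₂? same₁ same₂ C C₁ with maxClasses-split U? C
    ... | k , n , C∩ , C∖ , k+n≡m =
      n , maxClasses-cong (T? ∩? ∁? U?) T₂? same₂ C∖ ,
      trans (cong (_+ n) (classCount-unique {_~_ = Equiv} Equiv-sym (λ {u} → Equiv-trans {i = u})
                                            C₁ (maxClasses-cong (T? ∩? U?) T₁? same₁ C∩))) k+n≡m

open import Data.Integer using (ℤ; +_; _-_) renaming (_+_ to _+ℤ_)
import Data.Integer.Properties as ℤ
open import Data.Integer.Tactic.RingSolver using () renaming (solve-∀ to ℤ-solve-∀)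

+-minus : ∀ {a b c} → a + b ≡ c → + b ≡ + c - + a
+-minus {a} {b} refl = trans (minus (+ a) (+ b)) (cong (_- + a) (sym (ℤ.pos-+ a b)))
  where
  minus : ∀ (a b : ℤ) → b ≡ (a +ℤ b) - a
  minus = ℤ-solve-∀

inclusion-exclusion : ∀ {m₁ m₂ m₃ m₆ n₁ n₂ n₃ r} →
  m₆ + n₃ ≡ m₃ → m₆ + n₂ ≡ m₂ → m₃ + r ≡ m₁ → n₂ + n₁ ≡ r →
  + n₁ ≡ ((+ m₁ - + m₂) - + m₃) +ℤ + m₆
inclusion-exclusion {m₆ = m₆} {n₁} {n₂} {n₃} refl refl refl refl
  rewrite ℤ.pos-+ (m₆ + n₃) (n₂ + n₁) | ℤ.pos-+ m₆ n₃ | ℤ.pos-+ n₂ n₁ | ℤ.pos-+ m₆ n₂ =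
  identity (+ m₆) (+ n₁) (+ n₂) (+ n₃)
  where
  identity : ∀ (m₆ n₁ n₂ n₃ : ℤ) → n₁ ≡ (((m₆ +ℤ n₃) +ℤ (n₂ +ℤ n₁) - (m₆ +ℤ n₂)) - (m₆ +ℤ n₃)) +ℤ m₆
  identity = ℤ-solve-∀

corollary1p1 : (g : ℕ) → g ≥ 1 → (m₁ m₂ m₃ m₆ : ℕ) →
    IsM g 1 m₁ → IsM g 2 m₂ → IsM g 3 m₃ → IsM g 6 m₆ →
    NumMaxClasses g (λ w → AutOrder w 6) m₆ ×
    (∃ λ n₃ → NumMaxClasses g (λ w → AutOrder w 3) n₃ × (+ n₃ ≡ + m₃ - + m₆)) ×
    (∃ λ n₂ → NumMaxClasses g (λ w → AutOrder w 2) n₂ × (+ n₂ ≡ + m₂ - + m₆)) ×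
    (∃ λ n₁ → NumMaxClasses g (λ w → AutOrder w 1) n₁ × (+ n₁ ≡ ((+ m₁ - + m₂) - + m₃) +ℤ + m₆))
corollary1p1 g g≥1 m₁ m₂ m₃ m₆ M₁ M₂ M₃ M₆ =
  let (n₃ , N₃ , m₆+n₃≡m₃) = splitOff (3 ∣?_) (6 ∣?_) (6 ∣?_) (_≟ 3) refl refl M₃ M₆
      (n₂ , N₂ , m₆+n₂≡m₂) = splitOff (2 ∣?_) (6 ∣?_) (6 ∣?_) (_≟ 2) refl refl M₂ M₆
      (r  , R  , m₃+r≡m₁)  = splitOff (1 ∣?_) (3 ∣?_) (3 ∣?_) (_∣? 2) refl refl M₁ M₃
      (n₁ , N₁ , n₂+n₁≡r)  = splitOff (_∣? 2) (2 ∣?_) (_≟ 2) (_≟ 1) refl refl R N₂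
  in OrderSatisfies-≡ (maxClasses-cong g≥1 (6 ∣?_) (_≟ 6) refl M₆) ,
     (n₃ , OrderSatisfies-≡ N₃ , +-minus m₆+n₃≡m₃) ,
     (n₂ , OrderSatisfies-≡ N₂ , +-minus m₆+n₂≡m₂) ,
     (n₁ , OrderSatisfies-≡ N₁ , inclusion-exclusion m₆+n₃≡m₃ m₆+n₂≡m₂ m₃+r≡m₁ n₂+n₁≡r)
  where
  open MaxFormClasses g
  splitOff = maxClasses-splitOff g≥1
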